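{- A triangle-free graph $G$ on $n \geq 5$ vertices is strongly $T_3$-reconstructible if and only if $N(v_1) \neq N(v_2)$ for any two distinct non-adjacent vertices $v_1, v_2 \in V(G)$.
   Context: Graphs are finite, simple, connected and labeled; two labeled graphs are identical iff they have the same vertex set and edge set. $N(v)$ is the set of neighbors of $v$. $T_3(G)$ is the set of 3-element subsets of $V(G)$ inducing a connected subgraph of $G$. $G$ is strongly $T_3$-reconstructible if every finite, simple, connected labeled graph $H$ with $T_3(H) = T_3(G)$ is identical to $G$. -}

module Defs where

open import Data.Nat using (ℕ)
open import Data.Fin using (Fin)
open import Data.Bool using (Bool; true; false)
open import Data.Unit using (⊤)
open import Data.Empty using (⊥)
open import Data.Product using (_×_)
open import Data.Sum using (_⊎_)
open import Relation.Nullary using (¬_)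
open import Relation.Binary.PropositionalEquality using (_≡_; _≢_)

record Graph (n : ℕ) : Set where
  field
    adj    : Fin n → Fin n → Bool
    sym    : ∀ u v → adj u v ≡ adj v u
    irrefl : ∀ v → adj v v ≡ false
open Graph public

Adj : ∀ {n} → Graph n → Fin n → Fin n → Set
Adj G u v = adj G u v ≡ true

data WalkIn {n} (G : Graph n) (S : Fin n → Set) : Fin n → Fin n → Set where
  here : ∀ {u} → S u → WalkIn G S u u
  step : ∀ {u w v} → S u → Adj G u w → WalkIn G S w v → WalkIn G S u v

InducedConnected : ∀ {n} → Graph n → (Fin n → Set) → Set
InducedConnected G S = ∀ u v → S u → S v → WalkIn G S u v

Connected : ∀ {n} → Graph n → Set
Connected G = InducedConnected G (λ _ → ⊤)

InT3 : ∀ {n} → Graph n → Fin n → Fin n → Fin n → Set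
InT3 G a b c =
  a ≢ b × a ≢ c × b ≢ c ×
  InducedConnected G (λ x → x ≡ a ⊎ x ≡ b ⊎ x ≡ c)

SameT3 : ∀ {n} → Graph n → Graph n → Set
SameT3 G H = ∀ a b c → (InT3 G a b c → InT3 H a b c) × (InT3 H a b c → InT3 G a b c)

Identical : ∀ {n} → Graph n → Graph n → Set
Identical G H = ∀ u v → adj G u v ≡ adj H u v

StronglyT3Reconstructible : ∀ {n} → Graph n → Set
StronglyT3Reconstructible {n} G =
  (H : Graph n) → Connected H → SameT3 H G → Identical H G

TriangleFree : ∀ {n} → Graph n → Set
TriangleFree G = ∀ a b c → Adj G a b → Adj G b c → Adj G a c → ⊥

SameNeighbourhood : ∀ {n} → Graph n → Fin n → Fin n → Set
SameNeighbourhood G v₁ v₂ = ∀ w → adj G v₁ w ≡ adj G v₂ w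

DistinctNeighbourhoods : ∀ {n} → Graph n → Set
DistinctNeighbourhoods G =
  ∀ v₁ v₂ → v₁ ≢ v₂ → adj G v₁ v₂ ≡ false → ¬ SameNeighbourhood G v₁ v₂

{-# OPTIONS --safe #-}
module Submission where

-- A 3-set induces a connected subgraph iff it spans at least two of its three edges, so
-- T₃(G) = T₃(H) says that on every triple the edge indicators of G and H have the same
-- majority.  Joining two non-adjacent twins changes no majority, which gives one direction.
-- Conversely, if ab is an edge of one graph but not of the other, a third vertex is adjacent
-- to a or b in the first graph iff it is adjacent to both in the second.  Applied to an edge
-- uv of H missing from G, triangle-freeness of G shows that u and v must be twins in G, which
-- the hypothesis excludes; so H ⊆ G.  An edge uv of G missing from H would then make every
-- other neighbour of u or v a common neighbour, i.e. a triangle.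

open import Defs hiding (sym)
open import Data.Bool.Base using (Bool; true; false; _∧_; _∨_)
open import Data.Bool.Properties using (∨-zeroʳ; ∨-idem; ∧-zeroʳ; ∧-idem; ¬-not; ⇔→≡)
  renaming (_≟_ to _≟ᵇ_)
open import Data.Empty using (⊥)
open import Data.Fin.Base using (Fin)
open import Data.Fin.Properties using (_≟_; injective⇒≤; ¬∀⟶∃¬)
open import Data.List.Base using (List; []; _∷_; length)
open import Data.List.Membership.Propositional using (_∈_; _∉_)
open import Data.List.Membership.Setoid.Properties using (index-injective)
open import Data.List.Relation.Unary.Any using (here; there; any?)
open import Data.Nat.Base using (ℕ; _≤_; _<_; s≤s; z≤n)
open import Data.Nat.Properties using (<⇒≱; ≤-trans)
open import Data.Product.Base using (_×_; _,_; proj₁; proj₂; ∃; ∃₂; swap)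
open import Data.Sum.Base using (_⊎_; inj₁; inj₂)
open import Data.Unit.Base using (tt)
open import Function.Base using (_∘_)
open import Function.Bundles using (_⇔_; mk⇔; Equivalence)
open import Relation.Nullary.Decidable
  using (Dec; does; yes; no; _×-dec_; _⊎-dec_; dec-false; dec-true; does-⇔; decidable-stable)
open import Relation.Nullary.Negation using (¬_; contradiction)
open import Relation.Binary.PropositionalEquality
  using (_≡_; _≢_; refl; sym; trans; cong₂; subst₂; setoid; ≢-sym)

open Equivalence using (to)

private
  variable
    n : ℕ
    G H K L : Graph n
    a b c u v w x y z : Fin n

Adj-sym : (G : Graph n) → Adj G a b → Adj G b a
Adj-sym {a = a} {b} G gab = trans (Graph.sym G b a) gab

Adj⇒≢ : (G : Graph n) → Adj G a b → a ≢ b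
Adj⇒≢ {a = a} G gaa refl = contradiction (trans (sym gaa) (irrefl G a)) λ ()

Adj? : (G : Graph n) → ∀ a b → Dec (Adj G a b)
Adj? G a b = adj G a b ≟ᵇ true

_++ʷ_ : ∀ {S : Fin n → Set} → WalkIn G S a b → WalkIn G S b c → WalkIn G S a c
here _     ++ʷ q = q
step s e p ++ʷ q = step s e (p ++ʷ q)

WalkIn-mono : ∀ {S : Fin n → Set} → (∀ {x y} → Adj G x y → Adj H x y) →
              WalkIn G S a b → WalkIn H S a b
WalkIn-mono G⊆H (here s)     = here s
WalkIn-mono G⊆H (step s e p) = step s (G⊆H e) (WalkIn-mono G⊆H p)

first-step : ∀ {S : Fin n → Set} → a ≢ b → WalkIn G S a b → ∃ λ w → S w × Adj G a w
first-step a≢b (here _)                = contradiction refl a≢b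
first-step a≢b (step _ e (here s))     = _ , s , e
first-step a≢b (step _ e (step s _ _)) = _ , s , e

_∈?_ : (z : Fin n) (xs : List (Fin n)) → Dec (z ∈ xs)
z ∈? xs = any? (z ≟_) xs

covering⇒≤length : (xs : List (Fin n)) → (∀ z → z ∈ xs) → n ≤ length xs
covering⇒≤length xs cover =
  injective⇒≤ λ {z} {z′} → index-injective (setoid (Fin _)) (cover z) (cover z′)

walk-leaves : ∀ {S : Fin n → Set} {xs} → WalkIn G S a b → a ∈ xs → b ∉ xs →
              ∃₂ λ x y → x ∈ xs × y ∉ xs × Adj G x y
walk-leaves (here _) a∈ b∉ = contradiction a∈ b∉
walk-leaves {xs = xs} (step {w = w} _ e p) a∈ b∉ with w ∈? xs
... | yes w∈ = walk-leaves p w∈ b∉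
... | no  w∉ = _ , w , a∈ , w∉ , e

edge-leaving : Connected G → (xs : List (Fin n)) → length xs < n → u ∈ xs →
               ∃₂ λ x y → x ∈ xs × y ∉ xs × Adj G x y
edge-leaving {n = n} {u = u} conn xs short u∈
  with ¬∀⟶∃¬ n (_∈ xs) (_∈? xs) (λ cover → <⇒≱ short (covering⇒≤length xs cover))
... | z , z∉ = walk-leaves (conn u z tt tt) u∈ z∉

edge-leaving-pair : {u v : Fin n} → Connected G → 3 ≤ n →
                    ∃ λ z → z ≢ u × z ≢ v × (Adj G u z ⊎ Adj G v z)
edge-leaving-pair {u = u} {v} conn 3≤n with edge-leaving conn (u ∷ v ∷ []) 3≤n (here refl)
... | _ , z , here refl , z∉ , guz         = z , (z∉ ∘ here) , (z∉ ∘ there ∘ here) , inj₁ guz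
... | _ , z , there (here refl) , z∉ , gvz = z , (z∉ ∘ here) , (z∉ ∘ there ∘ here) , inj₂ gvz

majority : Bool → Bool → Bool → Bool
majority true  y z = y ∨ z
majority false y z = y ∧ z

∨≡true : ∀ {x y} → x ≡ true ⊎ y ≡ true → x ∨ y ≡ true
∨≡true     (inj₁ refl) = refl
∨≡true {x} (inj₂ refl) = ∨-zeroʳ x

∨≡true⁻ : ∀ {x y} → x ∨ y ≡ true → x ≡ true ⊎ y ≡ true
∨≡true⁻ {true}  _   = inj₁ refl
∨≡true⁻ {false} x∨y = inj₂ x∨y

∧≡true : ∀ {x y} → x ≡ true × y ≡ true → x ∧ y ≡ true
∧≡true (refl , refl) = refl

∧≡true⁻ : ∀ {x y} → x ∧ y ≡ true → x ≡ true × y ≡ true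
∧≡true⁻ {true} x∧y = refl , x∧y

majority≡true⁻ : ∀ {x y z} → majority x y z ≡ true →
                 x ≡ true × y ≡ true ⊎ x ≡ true × z ≡ true ⊎ y ≡ true × z ≡ true
majority≡true⁻ {true}  {true}  _   = inj₁ (refl , refl)
majority≡true⁻ {true}  {false} m   = inj₂ (inj₁ (refl , m))
majority≡true⁻ {false}         m   = inj₂ (inj₂ (∧≡true⁻ m))

majority≡true : ∀ {x y z} → x ≡ true ⊎ y ≡ true → x ≡ true ⊎ z ≡ true → y ≡ true ⊎ z ≡ true →
                majority x y z ≡ true
majority≡true {true}  _           _           y∨z = ∨≡true y∨z
majority≡true {false} (inj₂ refl) (inj₂ refl) _   = refl

majority-agree₂₃ : ∀ p p′ {q r} → q ≡ r → majority p q r ≡ majority p′ q r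
majority-agree₂₃ p p′ {q} refl = trans (decided p) (sym (decided p′))
  where
  decided : ∀ p → majority p q q ≡ q
  decided true  = ∨-idem q
  decided false = ∧-idem q

majority-agree₁₃ : ∀ p p′ {q r} → q ≡ r → majority q p r ≡ majority q p′ r
majority-agree₁₃ p p′ {true}  refl = trans (∨-zeroʳ p) (sym (∨-zeroʳ p′))
majority-agree₁₃ p p′ {false} refl = trans (∧-zeroʳ p) (sym (∧-zeroʳ p′))

majority-agree₁₂ : ∀ p p′ {q r} → q ≡ r → majority q r p ≡ majority q r p′
majority-agree₁₂ p p′ {true}  refl = refl
majority-agree₁₂ p p′ {false} refl = refl

Triple : Fin n → Fin n → Fin n → Fin n → Set
Triple a b c x = x ≡ a ⊎ x ≡ b ⊎ x ≡ c

connected₃ : Graph n → Fin n → Fin n → Fin n → Bool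
connected₃ G a b c = majority (adj G a b) (adj G a c) (adj G b c)

dominated⇒connected : ∀ {S : Fin n → Set} {p} → S p → (∀ {x} → S x → x ≡ p ⊎ Adj G p x) →
                      InducedConnected G S
dominated⇒connected {G = G} {S = S} {p} Sp dominated x y Sx Sy = to-centre Sx ++ʷ from-centre Sy
  where
  to-centre : ∀ {x} → S x → WalkIn G S x p
  to-centre Sx with dominated Sx
  ... | inj₁ refl = here Sx
  ... | inj₂ gpx  = step Sx (Adj-sym G gpx) (here Sp)
  from-centre : ∀ {y} → S y → WalkIn G S p y
  from-centre Sy with dominated Sy
  ... | inj₁ refl = here Sy
  ... | inj₂ gpy  = step Sp gpy (here Sy)

connected₃⇒InducedConnected : connected₃ G a b c ≡ true → InducedConnected G (Triple a b c)
connected₃⇒InducedConnected {G = G} {a} {b} {c} conn with majority≡true⁻ conn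
... | inj₁ (gab , gac) = dominated⇒connected (inj₁ refl) λ
  { (inj₁ refl)        → inj₁ refl
  ; (inj₂ (inj₁ refl)) → inj₂ gab
  ; (inj₂ (inj₂ refl)) → inj₂ gac }
... | inj₂ (inj₁ (gab , gbc)) = dominated⇒connected (inj₂ (inj₁ refl)) λ
  { (inj₁ refl)        → inj₂ (Adj-sym G gab)
  ; (inj₂ (inj₁ refl)) → inj₁ refl
  ; (inj₂ (inj₂ refl)) → inj₂ gbc }
... | inj₂ (inj₂ (gac , gbc)) = dominated⇒connected (inj₂ (inj₂ refl)) λ
  { (inj₁ refl)        → inj₂ (Adj-sym G gac)
  ; (inj₂ (inj₁ refl)) → inj₂ (Adj-sym G gbc)
  ; (inj₂ (inj₂ refl)) → inj₁ refl }

InT3⇒connected₃ : InT3 G a b c → connected₃ G a b c ≡ true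
InT3⇒connected₃ {G = G} {a} {b} {c} (a≢b , a≢c , b≢c , conn) = majority≡true at-a at-b at-c
  where
  neighbour : ∀ {x y} → Triple a b c x → Triple a b c y → x ≢ y →
              ∃ λ w → Triple a b c w × Adj G x w
  neighbour Sx Sy x≢y = first-step x≢y (conn _ _ Sx Sy)
  at-a : Adj G a b ⊎ Adj G a c
  at-a with neighbour (inj₁ refl) (inj₂ (inj₁ refl)) a≢b
  ... | _ , inj₁ refl , gaa          = contradiction refl (Adj⇒≢ G gaa)
  ... | _ , inj₂ (inj₁ refl) , gab   = inj₁ gab
  ... | _ , inj₂ (inj₂ refl) , gac   = inj₂ gac
  at-b : Adj G a b ⊎ Adj G b c
  at-b with neighbour (inj₂ (inj₁ refl)) (inj₁ refl) (≢-sym a≢b)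
  ... | _ , inj₁ refl , gba          = inj₁ (Adj-sym G gba)
  ... | _ , inj₂ (inj₁ refl) , gbb   = contradiction refl (Adj⇒≢ G gbb)
  ... | _ , inj₂ (inj₂ refl) , gbc   = inj₂ gbc
  at-c : Adj G a c ⊎ Adj G b c
  at-c with neighbour (inj₂ (inj₂ refl)) (inj₁ refl) (≢-sym a≢c)
  ... | _ , inj₁ refl , gca          = inj₁ (Adj-sym G gca)
  ... | _ , inj₂ (inj₁ refl) , gcb   = inj₂ (Adj-sym G gcb)
  ... | _ , inj₂ (inj₂ refl) , gcc   = contradiction refl (Adj⇒≢ G gcc)

SameT3-sym : SameT3 G H → SameT3 H G
SameT3-sym G≈H a b c = swap (G≈H a b c)

SameT3⇒connected₃-≡ : SameT3 G H → a ≢ b → a ≢ c → b ≢ c →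
                      connected₃ G a b c ≡ connected₃ H a b c
SameT3⇒connected₃-≡ {a = a} {b = b} {c = c} G≈H a≢b a≢c b≢c =
  ⇔→≡ (mk⇔ (transfer G≈H) (transfer (SameT3-sym G≈H)))
  where
  transfer : {K L : Graph _} → SameT3 K L → connected₃ K a b c ≡ true → connected₃ L a b c ≡ true
  transfer K≈L conn =
    InT3⇒connected₃ (proj₁ (K≈L a b c) (a≢b , a≢c , b≢c , connected₃⇒InducedConnected conn))

InT3-transfer : (a ≢ b → a ≢ c → b ≢ c → connected₃ G a b c ≡ connected₃ H a b c) →
                InT3 G a b c → InT3 H a b c
InT3-transfer agree t@(a≢b , a≢c , b≢c , _) =
  a≢b , a≢c , b≢c ,
  connected₃⇒InducedConnected (trans (sym (agree a≢b a≢c b≢c)) (InT3⇒connected₃ t))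

connected₃-≡⇒SameT3 : (∀ {a b c} → a ≢ b → a ≢ c → b ≢ c →
                                 connected₃ G a b c ≡ connected₃ H a b c) →
                      SameT3 G H
connected₃-≡⇒SameT3 agree a b c =
  InT3-transfer agree , InT3-transfer λ a≢b a≢c b≢c → sym (agree a≢b a≢c b≢c)

module _ (G : Graph n) {a b : Fin n} (a≢b : a ≢ b) where

  Joins : Fin n → Fin n → Set
  Joins x y = x ≡ a × y ≡ b ⊎ x ≡ b × y ≡ a

  joins? : ∀ x y → Dec (Joins x y)
  joins? x y = (x ≟ a ×-dec y ≟ b) ⊎-dec (x ≟ b ×-dec y ≟ a)

  Joins-sym : Joins x y → Joins y x
  Joins-sym (inj₁ (x≡a , y≡b)) = inj₂ (y≡b , x≡a)
  Joins-sym (inj₂ (x≡b , y≡a)) = inj₁ (y≡a , x≡b)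

  Joins-irrefl : ¬ Joins x x
  Joins-irrefl (inj₁ (refl , x≡b)) = a≢b x≡b
  Joins-irrefl (inj₂ (refl , x≡a)) = a≢b (sym x≡a)

  Joins-unique : Joins x y → Joins x z → y ≡ z
  Joins-unique (inj₁ (_ , refl)) (inj₁ (_ , refl)) = refl
  Joins-unique (inj₁ (refl , _)) (inj₂ (x≡b , _))  = contradiction x≡b a≢b
  Joins-unique (inj₂ (refl , _)) (inj₁ (x≡a , _))  = contradiction (sym x≡a) a≢b
  Joins-unique (inj₂ (_ , refl)) (inj₂ (_ , refl)) = refl

  addEdge : Graph n
  addEdge = record
    { adj    = λ x y → does (joins? x y) ∨ adj G x y
    ; sym    = λ x y → cong₂ _∨_ (does-⇔ (mk⇔ Joins-sym Joins-sym) (joins? x y) (joins? y x))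
                                 (Graph.sym G x y)
    ; irrefl = λ x → cong₂ _∨_ (dec-false (joins? x x) Joins-irrefl) (irrefl G x)
    }

  addEdge-adds : Adj addEdge a b
  addEdge-adds = cong₂ _∨_ (dec-true (joins? a b) (inj₁ (refl , refl))) refl

  addEdge-extends : Adj G x y → Adj addEdge x y
  addEdge-extends {x} {y} gxy = trans (cong₂ _∨_ refl gxy) (∨-zeroʳ (does (joins? x y)))

  addEdge-connected : Connected G → Connected addEdge
  addEdge-connected conn u v su sv = WalkIn-mono addEdge-extends (conn u v su sv)

  module _ (twins : SameNeighbourhood G a b) where

    Joins⇒twins : Joins x y → ∀ z → adj G x z ≡ adj G y z
    Joins⇒twins (inj₁ (refl , refl)) z = twins z
    Joins⇒twins (inj₂ (refl , refl)) z = sym (twins z)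

    addEdge-connected₃ : x ≢ y → x ≢ z → y ≢ z →
                         connected₃ addEdge x y z ≡ connected₃ G x y z
    addEdge-connected₃ {x} {y} {z} x≢y x≢z y≢z = by-cases (joins? x y) (joins? x z) (joins? y z)
      where
      by-cases : (jxy : Dec (Joins x y)) (jxz : Dec (Joins x z)) (jyz : Dec (Joins y z)) →
                 majority (does jxy ∨ adj G x y) (does jxz ∨ adj G x z) (does jyz ∨ adj G y z)
                   ≡ connected₃ G x y z
      by-cases (yes j) (yes j′) _       = contradiction (Joins-unique j j′) y≢z
      by-cases (yes j) _       (yes j′) = contradiction (Joins-unique (Joins-sym j) j′) x≢z
      by-cases _       (yes j) (yes j′) = contradiction (Joins-unique (Joins-sym j) (Joins-sym j′)) x≢y
      by-cases (no _)  (no _)  (no _)   = refl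
      by-cases (yes j) (no _)  (no _)   = majority-agree₂₃ true (adj G x y) (Joins⇒twins j z)
      by-cases (no _)  (yes j) (no _)   =
        majority-agree₁₃ true (adj G x z) (trans (Joins⇒twins j y) (Graph.sym G z y))
      by-cases (no _)  (no _)  (yes j)  =
        majority-agree₁₂ true (adj G y z)
          (trans (Graph.sym G x y) (trans (Joins⇒twins j x) (Graph.sym G z x)))

    addEdge-SameT3 : SameT3 addEdge G
    addEdge-SameT3 = connected₃-≡⇒SameT3 addEdge-connected₃

exclusive-edge : SameT3 K L → Adj K a b → ¬ Adj L a b → c ≢ a → c ≢ b →
                 (Adj K a c ⊎ Adj K b c) ⇔ (Adj L a c × Adj L b c)
exclusive-edge {K = K} {L} {a} {b} {c} K≈L kab ¬lab c≢a c≢b =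
  mk⇔ (∧≡true⁻ ∘ trans (sym agree) ∘ ∨≡true) (∨≡true⁻ ∘ trans agree ∘ ∧≡true)
  where
  agree : adj K a c ∨ adj K b c ≡ adj L a c ∧ adj L b c
  agree = subst₂ (λ p q → majority p (adj K a c) (adj K b c) ≡ majority q (adj L a c) (adj L b c))
                 kab (¬-not ¬lab)
                 (SameT3⇒connected₃-≡ K≈L (Adj⇒≢ K kab) (≢-sym c≢a) (≢-sym c≢b))

module _ {G H : Graph n} (H≈G : SameT3 H G) (G-triangleFree : TriangleFree G) where

  private
    H-only : Adj H a b → ¬ Adj G a b → c ≢ a → c ≢ b →
             (Adj H a c ⊎ Adj H b c) ⇔ (Adj G a c × Adj G b c)
    H-only = exclusive-edge H≈G

    G-only : Adj G a b → ¬ Adj H a b → c ≢ a → c ≢ b →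
             (Adj G a c ⊎ Adj G b c) ⇔ (Adj H a c × Adj H b c)
    G-only = exclusive-edge (SameT3-sym H≈G)

  module PrivateNeighbour (H-connected : Connected H) (5≤n : 5 ≤ n) {u v x : Fin n}
           (huv : Adj H u v) (¬guv : ¬ Adj G u v) (gux : Adj G u x) (¬gvx : ¬ Adj G v x) where

    x≢u : x ≢ u
    x≢u = ≢-sym (Adj⇒≢ G gux)

    x≢v : x ≢ v
    x≢v refl = ¬guv gux

    ¬hux : ¬ Adj H u x
    ¬hux hux = ¬gvx (proj₂ (to (H-only huv ¬guv x≢u x≢v) (inj₁ hux)))

    H-neighbour⇒common : w ≢ u → w ≢ v → Adj H u w ⊎ Adj H v w → Adj G u w × Adj G v w
    H-neighbour⇒common w≢u w≢v = to (H-only huv ¬guv w≢u w≢v)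

    module Common {w : Fin n} (guw : Adj G u w) (gvw : Adj G v w) where

      ¬gxw : ¬ Adj G x w
      ¬gxw gxw = G-triangleFree u x w gux gxw guw

      hxw : Adj H x w
      hxw = proj₂ (to (G-only gux ¬hux (≢-sym (Adj⇒≢ G guw)) λ { refl → ¬gvx gvw }) (inj₁ guw))

      ¬hvw : ¬ Adj H v w
      ¬hvw hvw = ¬gvx (Adj-sym G (proj₁ (to (H-only hxw ¬gxw (≢-sym x≢v) (Adj⇒≢ G gvw))
                                            (inj₂ (Adj-sym H hvw)))))

    only-neighbour-of-v : Adj H v w → w ≡ u
    only-neighbour-of-v {w} hvw = decidable-stable (w ≟ u) λ w≢u →
      let (guw , gvw) = H-neighbour⇒common w≢u (≢-sym (Adj⇒≢ H hvw)) (inj₂ hvw)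
      in Common.¬hvw guw gvw hvw

    another-neighbour-of-u : ∃ λ c → c ≢ u × c ≢ v × Adj H u c
    another-neighbour-of-u with edge-leaving-pair H-connected (≤-trans (s≤s (s≤s (s≤s z≤n))) 5≤n)
    ... | c , c≢u , c≢v , inj₁ huc = c , c≢u , c≢v , huc
    ... | c , c≢u , c≢v , inj₂ hvc = contradiction (only-neighbour-of-v hvc) c≢u

    -- With c a common G-neighbour of u and v, the H-component of u lies inside {u, v, c, x};
    -- this is where n ≥ 5 is needed (for n = 4 the paths x-u-c-v and v-u-c-x have the same T₃).
    absurd : ⊥
    absurd with another-neighbour-of-u
    ... | c , c≢u , c≢v , huc
      with H-neighbour⇒common c≢u c≢v (inj₁ huc)
         | edge-leaving H-connected (u ∷ v ∷ c ∷ x ∷ []) 5≤n (here refl)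
    ... | guc , gvc | _ , z , y∈ , z∉ , hyz = leaves y∈ hyz
      where
      open Common guc gvc renaming (¬gxw to ¬gxc; hxw to hxc; ¬hvw to ¬hvc)
      z≢u : z ≢ u
      z≢u = z∉ ∘ here
      z≢v : z ≢ v
      z≢v = z∉ ∘ there ∘ here
      z≢c : z ≢ c
      z≢c = z∉ ∘ there ∘ there ∘ here
      z≢x : z ≢ x
      z≢x = z∉ ∘ there ∘ there ∘ there ∘ here
      ¬hvz : ¬ Adj H v z
      ¬hvz hvz = z≢u (only-neighbour-of-v hvz)
      ¬gcz : ¬ Adj G c z
      ¬gcz gcz = ¬hvz (proj₁ (to (G-only gvc ¬hvc z≢v z≢c) (inj₂ gcz)))
      gvz⇒hvz : Adj G v z → Adj H v z
      gvz⇒hvz gvz = proj₁ (to (G-only gvc ¬hvc z≢v z≢c) (inj₁ gvz))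
      hxz∨hcz⇒gcz : Adj H x z ⊎ Adj H c z → Adj G c z
      hxz∨hcz⇒gcz = proj₂ ∘ to (H-only hxc ¬gxc z≢x z≢c)
      leaves : ∀ {y} → y ∈ u ∷ v ∷ c ∷ x ∷ [] → Adj H y z → ⊥
      leaves (here refl)                         huz =
        ¬hvz (gvz⇒hvz (proj₂ (H-neighbour⇒common z≢u z≢v (inj₁ huz))))
      leaves (there (here refl))                 hvz = ¬hvz hvz
      leaves (there (there (here refl)))         hcz = ¬gcz (hxz∨hcz⇒gcz (inj₂ hcz))
      leaves (there (there (there (here refl)))) hxz = ¬gcz (hxz∨hcz⇒gcz (inj₁ hxz))

  no-private-neighbour : Connected H → 5 ≤ n →
                         Adj H u v → ¬ Adj G u v → Adj G u x → ¬ Adj G v x → ⊥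
  no-private-neighbour H-connected 5≤n huv ¬guv gux ¬gvx =
    PrivateNeighbour.absurd H-connected 5≤n huv ¬guv gux ¬gvx

  H-edge⇒SameNeighbourhood : Connected H → 5 ≤ n →
                             Adj H u v → ¬ Adj G u v → SameNeighbourhood G u v
  H-edge⇒SameNeighbourhood H-connected 5≤n huv ¬guv w =
    ⇔→≡ (mk⇔ (shared huv ¬guv) (shared (Adj-sym H huv) (¬guv ∘ Adj-sym G)))
    where
    shared : Adj H a b → ¬ Adj G a b → Adj G a w → Adj G b w
    shared {b = b} hab ¬gab gaw =
      decidable-stable (Adj? G b w) (no-private-neighbour H-connected 5≤n hab ¬gab gaw)

  H-edge⇒G-edge : Connected H → 5 ≤ n → DistinctNeighbourhoods G → Adj H u v → Adj G u v
  H-edge⇒G-edge {u = u} {v} H-connected 5≤n distinct huv = decidable-stable (Adj? G u v) λ ¬guv →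
    distinct u v (Adj⇒≢ H huv) (¬-not ¬guv) (H-edge⇒SameNeighbourhood H-connected 5≤n huv ¬guv)

  G-edge⇒H-edge : Connected G → 3 ≤ n →
                  (∀ {u v} → Adj H u v → Adj G u v) → Adj G u v → Adj H u v
  G-edge⇒H-edge {u = u} {v} G-connected 3≤n H⊆G guv = decidable-stable (Adj? H u v) λ ¬huv →
    let (z , z≢u , z≢v , guz∨gvz) = edge-leaving-pair G-connected 3≤n
        (huz , hvz) = to (G-only guv ¬huv z≢u z≢v) guz∨gvz
    in G-triangleFree u v z guv (H⊆G hvz) (H⊆G huz)

theorem4p10 : (n : ℕ) → 5 ≤ n → (G : Graph n) → Connected G → TriangleFree G →
    StronglyT3Reconstructible G ⇔ DistinctNeighbourhoods G
theorem4p10 n 5≤n G G-connected G-triangleFree = mk⇔ reconstructible⇒distinct distinct⇒reconstructible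
  where
  reconstructible⇒distinct : StronglyT3Reconstructible G → DistinctNeighbourhoods G
  reconstructible⇒distinct reconstructible v₁ v₂ v₁≢v₂ ¬gv₁v₂ twins =
    contradiction (trans (sym (addEdge-adds G v₁≢v₂)) (trans (identical v₁ v₂) ¬gv₁v₂)) λ ()
    where
    identical : Identical (addEdge G v₁≢v₂) G
    identical = reconstructible (addEdge G v₁≢v₂) (addEdge-connected G v₁≢v₂ G-connected)
                                (addEdge-SameT3 G v₁≢v₂ twins)

  distinct⇒reconstructible : DistinctNeighbourhoods G → StronglyT3Reconstructible G
  distinct⇒reconstructible distinct H H-connected H≈G u v = ⇔→≡ (mk⇔ H⊆G G⊆H)
    where
    H⊆G : ∀ {u v} → Adj H u v → Adj G u v
    H⊆G = H-edge⇒G-edge H≈G G-triangleFree H-connected 5≤n distinct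
    G⊆H : Adj G u v → Adj H u v
    G⊆H = G-edge⇒H-edge H≈G G-triangleFree G-connected (≤-trans (s≤s (s≤s (s≤s z≤n))) 5≤n)
                        H⊆G
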